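{- Let $s,k$ be positive integers. There exists $D=D(s,k)$ such that the following holds. Let $G$ be a bipartite graph with parts $A,B$ whose edge set is $E(G)=(A\times B)\setminus\bigcup_{i=1}^k E_i$, where each $E_i\subseteq A\times B$ is the edge set of a vertex-disjoint union of complete bipartite graphs. Then either $K_{s,s}$ is a subgraph of $G$ or the minimum degree satisfies $\delta(G)\leq D$. -}

module Defs where

open import Data.Nat using (ℕ; _≤_; _+_)
open import Data.Fin using (Fin)
open import Data.Bool using (Bool; true; false; if_then_else_)
open import Data.Maybe using (Maybe; just)
open import Data.List using (map; allFin)
open import Data.Nat.ListAction using (sum)
open import Data.Product using (Σ; ∃; ∃-syntax; _×_; _,_)
open import Data.Sum using (_⊎_)
open import Function using (_⇔_)
open import Function.Definitions using (Injective)
open import Relation.Binary.PropositionalEquality using (_≡_)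

BipGraph : ℕ → ℕ → Set
BipGraph m n = Fin m → Fin n → Bool

-- Vertex-disjointness is encoded by
-- assigning to each vertex at most one biclique index: partA a ≡ just j
-- means a ∈ A_j, partB b ≡ just j means b ∈ B_j.
IsBicliqueUnion : {m n : ℕ} → (Fin m → Fin n → Set) → Set
IsBicliqueUnion {m} {n} E =
  Σ ℕ λ L → Σ (Fin m → Maybe (Fin L)) λ partA → Σ (Fin n → Maybe (Fin L)) λ partB →
    ∀ a b → E a b ⇔ (∃[ j ] (partA a ≡ just j × partB b ≡ just j))

degA : {m n : ℕ} → BipGraph m n → Fin m → ℕ
degA {m} {n} G a = sum (map (λ b → if G a b then 1 else 0) (allFin n))

degB : {m n : ℕ} → BipGraph m n → Fin n → ℕ
degB {m} {n} G b = sum (map (λ a → if G a b then 1 else 0) (allFin m))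

-- K_{s,s} is a subgraph of G (since K_{s,s} is connected bipartite, its two
-- sides embed into the two parts A, B).
ContainsKss : {m n : ℕ} → ℕ → BipGraph m n → Set
ContainsKss {m} {n} s G =
  Σ (Fin s → Fin m) λ S → Σ (Fin s → Fin n) λ T →
    Injective _≡_ _≡_ S × Injective _≡_ _≡_ T × (∀ i j → G (S i) (T j) ≡ true)

MinDegreeAtMost : {m n : ℕ} → BipGraph m n → ℕ → Set
MinDegreeAtMost G D = (∃[ a ] (degA G a ≤ D)) ⊎ (∃[ b ] (degB G b ≤ D))

module Submission where

open import Defs
open import Data.Nat using (ℕ; _≤_; _+_)
open import Data.Fin using (Fin)
open import Data.Bool using (true)
open import Data.Product using (∃-syntax)
open import Data.Sum using (_⊎_)
open import Function using (_⇔_)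
open import Relation.Nullary using (¬_)
open import Relation.Binary.PropositionalEquality using (_≡_)

open import Data.Nat using (zero; suc; _*_; _<_; z≤n; s≤s; _≤?_)
open import Data.Nat.Properties
  using (≤-refl; ≤-trans; ≤-reflexive; <⇒≤; ≰⇒>; n≤1+n; m≤m+n; m≤m*n; +-suc; *-identityʳ;
         +-mono-≤; +-monoˡ-≤; +-monoʳ-≤; +-cancelˡ-≤; +-cancelʳ-≤; module ≤-Reasoning)
import Data.Fin as Fin
open import Data.Fin.Properties using (any?; all?; ¬∀⟶∃¬; inject≤-injective)
open import Data.Bool using (Bool; false; if_then_else_)
import Data.Bool.Properties as Bool
open import Data.Maybe using (Maybe; just)
import Data.Maybe.Properties as Maybe
open import Data.List using (List; []; _∷_; length; filter; map; lookup; allFin)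
open import Data.List.Properties
  using (filter-accept; filter-none; filter-all; length-filter; length-tabulate)
open import Data.Nat.ListAction using (sum)
open import Data.List.Relation.Unary.All as All using (All)
open import Data.List.Relation.Unary.AllPairs using ([]; _∷_)
open import Data.List.Relation.Unary.Any using (here; there)
open import Data.List.Relation.Unary.Unique.Propositional using (Unique)
open import Data.List.Relation.Unary.Unique.Propositional.Properties using (filter⁺; allFin⁺)
open import Data.List.Membership.Propositional using (_∈_)
open import Data.List.Membership.Propositional.Properties using (∈-lookup; ∈-filter⁻)
open import Data.List.Relation.Binary.Subset.Propositional using (_⊆_)
open import Data.List.Relation.Binary.Subset.Propositional.Properties
  using (⊆-trans; ∷⁺ʳ; xs⊆x∷xs; filter-⊆)
open import Data.Product using (Σ; _×_; _,_; proj₁; proj₂)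
open import Data.Sum using (inj₁; inj₂)
open import Data.Empty using (⊥; ⊥-elim)
open import Data.Unit using (tt)
open import Function using (id; _∘_)
open import Function.Bundles using (Equivalence)
open import Function.Definitions using (Injective)
open import Level using (0ℓ)
open import Relation.Nullary using (yes; no; _×-dec_)
open import Relation.Nullary.Decidable using (toSum)
open import Relation.Unary using (Pred; Decidable)
open import Relation.Unary.Properties using (∁?)
open import Relation.Binary.Definitions using (DecidableEquality)
open import Relation.Binary.PropositionalEquality using (_≢_; refl; sym; trans; cong)

-- Let E_1, …, E_k be the removed unions of bicliques, and for
-- each colour i let partA i : A → Maybe (index of a biclique) record which
-- biclique of E_i a vertex of A lies in.  A pair (a , b) is a non-edge iff a
-- and b lie in a common biclique of some colour.
--
-- 1. Homogenisation (a pigeonhole dichotomy applied k times): among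
--    tower R k = R^(2^k) vertices of A there are R vertices Y on which every
--    map partA i is constant or injective.
-- 2. Take R = s + s·k and a₀ ∈ Y.  If a neighbour b of a₀ misses some a ∈ Y,
--    then a and b share a biclique of some colour i; partA i cannot be
--    constant on Y (a₀ would share it too), so it is injective and at most
--    one such a exists per colour.  Hence b misses at most k vertices of Y.
-- 3. If deg a₀ > D ≥ s, pick s neighbours T of a₀.  By the union bound at
--    most s·k vertices of Y miss a vertex of T, so s vertices of Y are
--    complete to T: a K_{s,s}.
-- 4. With D = tower (s + s·k) k: if |A| ≤ D some vertex has degree ≤ |A| ≤ D,
--    otherwise steps 1–3 apply.

module Counting {A : Set} where

  count : {P : Pred A 0ℓ} → Decidable P → List A → ℕ
  count P? xs = length (filter P? xs)

  count-∷ : {P : Pred A 0ℓ} (P? : Decidable P) {x : A} (xs : List A) →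
    count P? xs ≤ count P? (x ∷ xs)
  count-∷ P? {x} xs with P? x
  ... | yes _ = n≤1+n _
  ... | no _  = ≤-refl

  count-⊆-∪ : {P Q R : Pred A 0ℓ} (P? : Decidable P) (Q? : Decidable Q) (R? : Decidable R) →
    (∀ {x} → P x → Q x ⊎ R x) → (xs : List A) →
    count P? xs ≤ count Q? xs + count R? xs
  count-⊆-∪ P? Q? R? cover [] = z≤n
  count-⊆-∪ P? Q? R? cover (x ∷ xs) with ih ← count-⊆-∪ P? Q? R? cover xs | P? x
  ... | no _ = ≤-trans ih (+-mono-≤ (count-∷ Q? xs) (count-∷ R? xs))
  ... | yes px with cover px
  ...   | inj₁ qx = begin
    suc (count P? xs)                            ≤⟨ s≤s (≤-trans ih (+-monoʳ-≤ _ (count-∷ R? xs))) ⟩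
    suc (count Q? xs) + count R? (x ∷ xs)        ≡⟨ cong (λ ys → length ys + count R? (x ∷ xs)) (sym (filter-accept Q? qx)) ⟩
    count Q? (x ∷ xs) + count R? (x ∷ xs)        ∎
    where open ≤-Reasoning
  ...   | inj₂ rx = begin
    suc (count P? xs)                            ≤⟨ s≤s (≤-trans ih (+-monoˡ-≤ _ (count-∷ Q? xs))) ⟩
    suc (count Q? (x ∷ xs) + count R? xs)        ≡⟨ sym (+-suc _ _) ⟩
    count Q? (x ∷ xs) + suc (count R? xs)        ≡⟨ cong (λ ys → count Q? (x ∷ xs) + length ys) (sym (filter-accept R? rx)) ⟩
    count Q? (x ∷ xs) + count R? (x ∷ xs)        ∎
    where open ≤-Reasoning

  length≤count+count∁ : {P : Pred A 0ℓ} (P? : Decidable P) (xs : List A) →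
    length xs ≤ count P? xs + count (∁? P?) xs
  length≤count+count∁ P? xs = begin
    length xs               ≡⟨ cong length (sym (filter-all (λ _ → yes tt) (All.universal _ xs))) ⟩
    count (λ _ → yes tt) xs ≤⟨ count-⊆-∪ (λ _ → yes tt) P? (∁? P?) (λ {x} _ → toSum (P? x)) xs ⟩
    count P? xs + count (∁? P?) xs ∎
    where open ≤-Reasoning

  union-bound : (c : ℕ) {P : Pred A 0ℓ} (P? : Decidable P) {Q : Fin c → Pred A 0ℓ}
    (Q? : ∀ i → Decidable (Q i)) {b : ℕ} (xs : List A) →
    (∀ {x} → P x → ∃[ i ] Q i x) → (∀ i → count (Q? i) xs ≤ b) →
    count P? xs ≤ c * b
  union-bound zero P? {Q} Q? xs cover few =
    ≤-reflexive (cong length (filter-none P? (All.universal (λ x px → nowhere (cover px)) xs)))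
    where
      nowhere : ∀ {x} → ∃[ i ] Q i x → ⊥
      nowhere (() , _)
  union-bound (suc c) {P} P? {Q} Q? xs cover few = ≤-trans
    (count-⊆-∪ P? (Q? Fin.zero) Qsuc? split xs)
    (+-mono-≤ (few Fin.zero) (union-bound c Qsuc? (Q? ∘ Fin.suc) xs id (few ∘ Fin.suc)))
    where
      Qsuc? : Decidable (λ x → ∃[ i ] Q (Fin.suc i) x)
      Qsuc? x = any? (λ i → Q? (Fin.suc i) x)
      split : ∀ {x} → P x → Q Fin.zero x ⊎ ∃[ i ] Q (Fin.suc i) x
      split px with cover px
      ... | Fin.zero , q  = inj₁ q
      ... | Fin.suc i , q = inj₂ (i , q)

  count≤1 : {P : Pred A 0ℓ} (P? : Decidable P) {xs : List A} → Unique xs →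
    (∀ {x y} → x ∈ xs → y ∈ xs → P x → P y → x ≡ y) → count P? xs ≤ 1
  count≤1 P? {[]} _ _ = z≤n
  count≤1 {P} P? {x ∷ xs} (x∉xs ∷ unique) same with P? x
  ... | no _   = count≤1 P? unique (λ x∈ y∈ → same (there x∈) (there y∈))
  ... | yes px = s≤s (≤-reflexive (cong length (filter-none P? (All.tabulate others))))
    where
      others : ∀ {y} → y ∈ xs → ¬ P y
      others y∈ py = All.lookup x∉xs y∈ (same (here refl) (there y∈) px py)

  sum-indicator : (g : A → Bool) (xs : List A) →
    sum (map (λ x → if g x then 1 else 0) xs) ≡ count (λ x → g x Bool.≟ true) xs
  sum-indicator g [] = refl
  sum-indicator g (x ∷ xs) with g x
  ... | true  = cong suc (sum-indicator g xs)
  ... | false = sum-indicator g xs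

  lookup-injective : {xs : List A} → Unique xs → ∀ i j → lookup xs i ≡ lookup xs j → i ≡ j
  lookup-injective (_ ∷ _) Fin.zero Fin.zero _ = refl
  lookup-injective (x∉ ∷ _) Fin.zero (Fin.suc j) eq = ⊥-elim (All.lookup x∉ (∈-lookup j) eq)
  lookup-injective (x∉ ∷ _) (Fin.suc i) Fin.zero eq = ⊥-elim (All.lookup x∉ (∈-lookup i) (sym eq))
  lookup-injective (_ ∷ u) (Fin.suc i) (Fin.suc j) eq = cong Fin.suc (lookup-injective u i j eq)

  choose : (s : ℕ) {xs : List A} → Unique xs → s ≤ length xs →
    Σ (Fin s → A) λ f → Injective _≡_ _≡_ f × (∀ q → f q ∈ xs)
  choose s {xs} unique s≤ =
    (λ q → lookup xs (Fin.inject≤ q s≤)) ,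
    (λ {q} {r} eq → inject≤-injective s≤ s≤ q r (lookup-injective unique _ _ eq)) ,
    (λ q → ∈-lookup (Fin.inject≤ q s≤))

open Counting

record Refinement {X : Set} (xs : List X) (t : ℕ) (P : List X → Set) : Set where
  constructor refinement
  field
    elems    : List X
    ⊆xs      : elems ⊆ xs
    unique   : Unique elems
    large    : t ≤ length elems
    property : P elems

refinement-⊆ : {X : Set} {xs zs : List X} {t : ℕ} {P : List X → Set} →
  xs ⊆ zs → Refinement xs t P → Refinement zs t P
refinement-⊆ xs⊆zs (refinement ys ys⊆xs u large p) = refinement ys (⊆-trans ys⊆xs xs⊆zs) u large p

unique-∷ : {X : Set} {x : X} {xs ys : List X} → All (x ≢_) xs → ys ⊆ xs → Unique ys → Unique (x ∷ ys)
unique-∷ x∉xs ys⊆xs u = All.tabulate (λ y∈ys → All.lookup x∉xs (ys⊆xs y∈ys)) ∷ u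

module _ {X Y : Set} (f : X → Y) where

  ConstantOn : List X → Set
  ConstantOn ys = ∀ {x y} → x ∈ ys → y ∈ ys → f x ≡ f y

  InjectiveOn : List X → Set
  InjectiveOn ys = ∀ {x y} → x ∈ ys → y ∈ ys → f x ≡ f y → x ≡ y

  HomogeneousOn : List X → Set
  HomogeneousOn ys = ConstantOn ys ⊎ InjectiveOn ys

  homogeneous-⊆ : {xs ys : List X} → ys ⊆ xs → HomogeneousOn xs → HomogeneousOn ys
  homogeneous-⊆ ys⊆xs (inj₁ const) = inj₁ (λ x∈ y∈ → const (ys⊆xs x∈) (ys⊆xs y∈))
  homogeneous-⊆ ys⊆xs (inj₂ inj)   = inj₂ (λ x∈ y∈ → inj (ys⊆xs x∈) (ys⊆xs y∈))

  injectiveOn-∷ : {x : X} {ys : List X} → (∀ {y} → y ∈ ys → f y ≢ f x) →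
    InjectiveOn ys → InjectiveOn (x ∷ ys)
  injectiveOn-∷ new inj (here refl) (here refl) _ = refl
  injectiveOn-∷ new inj (here refl) (there y∈) e  = ⊥-elim (new y∈ (sym e))
  injectiveOn-∷ new inj (there x∈) (here refl) e  = ⊥-elim (new x∈ e)
  injectiveOn-∷ new inj (there x∈) (there y∈) e   = inj x∈ y∈ e

module Homogenisation {X Y : Set} (_≟_ : DecidableEquality Y) (f : X → Y) where

  sameClass? : (x : X) → Decidable (λ y → f y ≡ f x)
  sameClass? x y = f y ≟ f x

  class rest : X → List X → List X
  class x = filter (sameClass? x)
  rest  x = filter (∁? (sameClass? x))

  class-constant : (x : X) (xs : List X) → ConstantOn f (x ∷ class x xs)
  class-constant x xs y∈ z∈ = trans (toClass y∈) (sym (toClass z∈))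
    where
      toClass : ∀ {y} → y ∈ x ∷ class x xs → f y ≡ f x
      toClass (here refl) = refl
      toClass (there y∈)  = proj₂ (∈-filter⁻ (sameClass? x) {xs = xs} y∈)

  rest-large : ∀ r t x xs → length (x ∷ class x xs) ≤ t → suc r * t ≤ length (x ∷ xs) →
    r * t ≤ length (rest x xs)
  rest-large r t x xs class≤t rt≤ = +-cancelˡ-≤ t _ _ (begin
    t + r * t                                      ≤⟨ rt≤ ⟩
    suc (length xs)                                ≤⟨ s≤s (length≤count+count∁ (sameClass? x) xs) ⟩
    length (x ∷ class x xs) + length (rest x xs)   ≤⟨ +-monoˡ-≤ _ class≤t ⟩
    t + length (rest x xs)                         ∎)
    where open ≤-Reasoning

  -- Either the class of
  -- the first element is large, or it is discarded and we recurse on the rest.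
  injective-or-constant : ∀ r t (xs : List X) → Unique xs → r * t ≤ length xs →
    Refinement xs r (InjectiveOn f) ⊎ Refinement xs t (ConstantOn f)
  injective-or-constant zero t xs _ _ = inj₁ (refinement [] (λ ()) [] z≤n (λ ()))
  injective-or-constant (suc r) t [] _ rt≤0 =
    inj₂ (refinement [] (λ ()) [] (≤-trans (m≤m+n t (r * t)) rt≤0) (λ ()))
  injective-or-constant (suc r) t (x ∷ xs) (x∉xs ∷ unique) rt≤ with t ≤? length (x ∷ class x xs)
  ... | yes t≤class = inj₂ (refinement (x ∷ class x xs) (∷⁺ʳ x (filter-⊆ (sameClass? x) xs))
          (unique-∷ x∉xs (filter-⊆ (sameClass? x) xs) (filter⁺ (sameClass? x) unique)) t≤class
          (class-constant x xs))
  ... | no t≰class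
    with injective-or-constant r t (rest x xs) (filter⁺ (∁? (sameClass? x)) unique)
           (rest-large r t x xs (<⇒≤ (≰⇒> t≰class)) rt≤)
  ...   | inj₂ constant = inj₂ (refinement-⊆ (⊆-trans (filter-⊆ _ xs) (xs⊆x∷xs xs x)) constant)
  ...   | inj₁ (refinement ys ys⊆rest u large inj) =
    inj₁ (refinement (x ∷ ys) (∷⁺ʳ x ys⊆xs) (unique-∷ x∉xs ys⊆xs u) (s≤s large)
           (injectiveOn-∷ f (λ y∈ → proj₂ (∈-filter⁻ (∁? (sameClass? x)) {xs = xs} (ys⊆rest y∈))) inj))
    where
      ys⊆xs : ys ⊆ xs
      ys⊆xs = ⊆-trans ys⊆rest (filter-⊆ _ xs)

  homogeneous-refinement : ∀ t (xs : List X) → Unique xs → t * t ≤ length xs →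
    Refinement xs t (HomogeneousOn f)
  homogeneous-refinement t xs u tt≤ with injective-or-constant t t xs u tt≤
  ... | inj₁ (refinement ys sub uys large inj)   = refinement ys sub uys large (inj₂ inj)
  ... | inj₂ (refinement ys sub uys large const) = refinement ys sub uys large (inj₁ const)

open Homogenisation using (homogeneous-refinement)

-- tower R c = R^(2^c): each homogenisation step takes a square root of the size.
tower : ℕ → ℕ → ℕ
tower R zero    = R
tower R (suc c) = tower R c * tower R c

R≤tower : ∀ R c → R ≤ tower R c
R≤tower R zero    = ≤-refl
R≤tower R (suc c) = ≤-trans (R≤tower R c) (n≤n*n (tower R c))
  where
    n≤n*n : ∀ n → n ≤ n * n
    n≤n*n zero      = z≤n
    n≤n*n n@(suc _) = m≤m*n n n

simultaneous-homogenisation : {X : Set} (c : ℕ) {Y : Fin c → Set}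
  (dec : ∀ i → DecidableEquality (Y i)) (f : ∀ i → X → Y i)
  (R : ℕ) (xs : List X) → Unique xs → tower R c ≤ length xs →
  Refinement xs R (λ ys → ∀ i → HomogeneousOn (f i) ys)
simultaneous-homogenisation zero dec f R xs u large = refinement xs id u large (λ ())
simultaneous-homogenisation (suc c) dec f R xs u large
  with refinement ys ys⊆xs uys ys-large homog₀ ← homogeneous-refinement (dec Fin.zero) (f Fin.zero) (tower R c) xs u large
  with refinement zs zs⊆ys uzs zs-large homog ← simultaneous-homogenisation c (dec ∘ Fin.suc) (f ∘ Fin.suc) R ys uys ys-large
  = refinement zs (⊆-trans zs⊆ys ys⊆xs) uzs zs-large
      λ { Fin.zero → homogeneous-⊆ (f Fin.zero) zs⊆ys homog₀ ; (Fin.suc i) → homog i }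

-- If |A| ≤ D then δ(G) ≤ D: a vertex of B has at most |A| neighbours, and if B
-- is empty every vertex of A is isolated.
small-side : ∀ {m n} (G : BipGraph m n) (D : ℕ) → m ≤ D → 1 ≤ m + n → MinDegreeAtMost G D
small-side {suc m} {zero}  G D m≤D _ = inj₁ (Fin.zero , z≤n)
small-side {m}     {suc n} G D m≤D _ = inj₂ (Fin.zero , (begin
  degB G Fin.zero                                         ≡⟨ sum-indicator (λ a → G a Fin.zero) (allFin m) ⟩
  count (λ a → G a Fin.zero Bool.≟ true) (allFin m)       ≤⟨ length-filter _ (allFin m) ⟩
  length (allFin m)                                       ≡⟨ length-tabulate id ⟩
  m                                                       ≤⟨ m≤D ⟩
  D                                                       ∎))
  where open ≤-Reasoning

module BicliqueComplement {k m n : ℕ} (G : BipGraph m n) (E : Fin k → Fin m → Fin n → Set)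
  (bicliques : ∀ i → IsBicliqueUnion (E i))
  (adjacency : ∀ a b → (G a b ≡ true) ⇔ (∀ i → ¬ E i a b)) where

  partA : ∀ i → Fin m → Maybe (Fin (proj₁ (bicliques i)))
  partA i = proj₁ (proj₂ (bicliques i))

  partB : ∀ i → Fin n → Maybe (Fin (proj₁ (bicliques i)))
  partB i = proj₁ (proj₂ (proj₂ (bicliques i)))

  Conflict : Fin k → Fin m → Fin n → Set
  Conflict i a b = ∃[ j ] (partA i a ≡ just j × partB i b ≡ just j)

  E⇔conflict : ∀ i a b → E i a b ⇔ Conflict i a b
  E⇔conflict i a b = proj₂ (proj₂ (proj₂ (bicliques i))) a b

  conflict? : ∀ i b → Decidable (λ a → Conflict i a b)
  conflict? i b a = any? (λ j → (partA i a ≟ just j) ×-dec (partB i b ≟ just j))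
    where
      _≟_ : DecidableEquality (Maybe (Fin (proj₁ (bicliques i))))
      _≟_ = Maybe.≡-dec Fin._≟_

  edge⇒no-conflict : ∀ {a b} → G a b ≡ true → ∀ i → ¬ Conflict i a b
  edge⇒no-conflict {a} {b} edge i c = Equivalence.to (adjacency a b) edge i (Equivalence.from (E⇔conflict i a b) c)

  non-edge⇒conflict : ∀ {a b} → ¬ G a b ≡ true → ∃[ i ] Conflict i a b
  non-edge⇒conflict {a} {b} non-edge with any? (λ i → conflict? i b a)
  ... | yes conflict = conflict
  ... | no none = ⊥-elim (non-edge (Equivalence.from (adjacency a b)
                    (λ i e → none (i , Equivalence.to (E⇔conflict i a b) e))))

  adjacent? : ∀ b → Decidable (λ a → G a b ≡ true)
  adjacent? b a = G a b Bool.≟ true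

  -- Let Y be a set on which every partA i is homogeneous and a₀ ∈ Y a
  -- neighbour of b.  Then b is adjacent to all but at most k elements of Y:
  -- a non-neighbour shares a biclique with b in some colour i; if partA i is
  -- constant on Y then a₀ would too, so it is injective and that biclique
  -- meets Y in at most one vertex.
  few-non-neighbours : {Y : List (Fin m)} → Unique Y → (∀ i → HomogeneousOn (partA i) Y) →
    ∀ {a₀ b} → a₀ ∈ Y → G a₀ b ≡ true → count (∁? (adjacent? b)) Y ≤ k
  few-non-neighbours {Y} unique homog {a₀} {b} a₀∈Y edge = begin
    count (∁? (adjacent? b)) Y ≤⟨ union-bound k (∁? (adjacent? b)) (λ i → conflict? i b) Y non-edge⇒conflict
                                    (λ i → count≤1 (conflict? i b) unique (shared i (homog i))) ⟩
    k * 1                      ≡⟨ *-identityʳ k ⟩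
    k                          ∎
    where
      open ≤-Reasoning
      shared : ∀ i → HomogeneousOn (partA i) Y → ∀ {a a′} → a ∈ Y → a′ ∈ Y →
        Conflict i a b → Conflict i a′ b → a ≡ a′
      shared i (inj₁ const) a∈Y _ (j , aj , bj) _ =
        ⊥-elim (edge⇒no-conflict edge i (j , trans (const a₀∈Y a∈Y) aj , bj))
      shared i (inj₂ inj) a∈Y a′∈Y (j , aj , bj) (j′ , a′j′ , bj′) =
        inj a∈Y a′∈Y (trans aj (trans (sym bj) (trans bj′ (sym a′j′))))

  completeTo? : ∀ {s} (T : Fin s → Fin n) → Decidable (λ a → ∀ q → G a (T q) ≡ true)
  completeTo? T a = all? (λ q → adjacent? (T q) a)

  -- If Y (homogeneous, of size ≥ s + s·k) contains a common neighbour a₀ of s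
  -- vertices T, then at least s elements of Y are complete to T: by the union
  -- bound over T at most s·k elements of Y miss some vertex of T.
  common-neighbours : ∀ {s} (T : Fin s → Fin n) {Y : List (Fin m)} → Unique Y →
    s + s * k ≤ length Y → (∀ i → HomogeneousOn (partA i) Y) →
    ∀ {a₀} → a₀ ∈ Y → (∀ q → G a₀ (T q) ≡ true) → s ≤ count (completeTo? T) Y
  common-neighbours {s} T {Y} unique large homog a₀∈Y a₀~T = +-cancelʳ-≤ (s * k) s _ (begin
    s + s * k                                                 ≤⟨ large ⟩
    length Y                                                  ≤⟨ length≤count+count∁ (completeTo? T) Y ⟩
    count (completeTo? T) Y + count (∁? (completeTo? T)) Y    ≤⟨ +-monoʳ-≤ _ incomplete ⟩
    count (completeTo? T) Y + s * k                           ∎)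
    where
      open ≤-Reasoning
      incomplete : count (∁? (completeTo? T)) Y ≤ s * k
      incomplete = union-bound s (∁? (completeTo? T)) (λ q → ∁? (adjacent? (T q))) Y
        (λ {a} → ¬∀⟶∃¬ s _ (λ q → adjacent? (T q) a))
        (λ q → few-non-neighbours unique homog a₀∈Y (a₀~T q))

  neighbours : Fin m → List (Fin n)
  neighbours a = filter (λ b → adjacent? b a) (allFin n)

  kss-from-neighbourhood : ∀ s {Y : List (Fin m)} → Unique Y → s + s * k ≤ length Y →
    (∀ i → HomogeneousOn (partA i) Y) → ∀ {a₀} → a₀ ∈ Y → s ≤ length (neighbours a₀) →
    ContainsKss s G
  kss-from-neighbourhood s {Y} unique large homog {a₀} a₀∈Y s≤deg
    with T , T-injective , T⊆N ← choose s (filter⁺ (λ b → adjacent? b a₀) (allFin⁺ n)) s≤deg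
    with S , S-injective , S⊆C ← choose s (filter⁺ (completeTo? T) unique)
           (common-neighbours T unique large homog a₀∈Y
              (λ q → proj₂ (∈-filter⁻ (λ b → adjacent? b a₀) {xs = allFin n} (T⊆N q))))
    = S , T , S-injective , T-injective , λ p → proj₂ (∈-filter⁻ (completeTo? T) {xs = Y} (S⊆C p))

  kss-or-low-degree : ∀ s D → 1 ≤ s → s ≤ D → {Y : List (Fin m)} → Unique Y → s + s * k ≤ length Y →
    (∀ i → HomogeneousOn (partA i) Y) → ContainsKss s G ⊎ MinDegreeAtMost G D
  kss-or-low-degree zero    D () _
  kss-or-low-degree (suc s) D _ s≤D {[]} unique () homog
  kss-or-low-degree s       D _ s≤D {a₀ ∷ Y} unique large homog with degA G a₀ ≤? D
  ... | yes low  = inj₂ (inj₁ (a₀ , low))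
  ... | no  high = inj₁ (kss-from-neighbourhood s unique large homog (here refl) s≤deg)
    where
      s≤deg : s ≤ length (neighbours a₀)
      s≤deg = ≤-trans s≤D (≤-trans (<⇒≤ (≰⇒> high)) (≤-reflexive (sum-indicator (G a₀) (allFin n))))

  kss-or-low-degree-large : ∀ s → 1 ≤ s → tower (s + s * k) k < m →
    ContainsKss s G ⊎ MinDegreeAtMost G (tower (s + s * k) k)
  kss-or-low-degree-large s 1≤s D<m
    with refinement Y _ unique large homog ← simultaneous-homogenisation k (λ _ → Maybe.≡-dec Fin._≟_) partA
           (s + s * k) (allFin m) (allFin⁺ m) (≤-trans (<⇒≤ D<m) (≤-reflexive (sym (length-tabulate id))))
    = kss-or-low-degree s D 1≤s (≤-trans (m≤m+n s (s * k)) (R≤tower (s + s * k) k)) unique large homog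
    where
      D : ℕ
      D = tower (s + s * k) k

mainTheorem17 : (s k : ℕ) → 1 ≤ s → 1 ≤ k →
    ∃[ D ] ((m n : ℕ) (G : BipGraph m n) (E : Fin k → Fin m → Fin n → Set) →
      (∀ i → IsBicliqueUnion (E i)) →
      (∀ a b → (G a b ≡ true) ⇔ (∀ i → ¬ E i a b)) →
      1 ≤ m + n →
      ContainsKss s G ⊎ MinDegreeAtMost G D)
mainTheorem17 s k 1≤s _ = D , kss-or-small-degree
  where
    D : ℕ
    D = tower (s + s * k) k
    kss-or-small-degree : (m n : ℕ) (G : BipGraph m n) (E : Fin k → Fin m → Fin n → Set) →
      (∀ i → IsBicliqueUnion (E i)) →
      (∀ a b → (G a b ≡ true) ⇔ (∀ i → ¬ E i a b)) →
      1 ≤ m + n →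
      ContainsKss s G ⊎ MinDegreeAtMost G D
    kss-or-small-degree m n G E bicliques adjacency nonempty with m ≤? D
    ... | yes m≤D = inj₂ (small-side G D m≤D nonempty)
    ... | no  m≰D = BicliqueComplement.kss-or-low-degree-large G E bicliques adjacency s 1≤s (≰⇒> m≰D)
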